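{- Let $D$ be a Hamiltonian digraph of odd order and let $C$ be a Hamiltonian cycle of $D$. If every vertex of $D$ is the head of an even chord of $C$, then $\overrightarrow{pc}(D)\le 2$.
   Context: All digraphs are finite, loopless, without parallel arcs (opposite arcs are allowed). A directed path in an arc-coloured digraph is properly coloured if no two consecutive arcs on it have the same colour. An arc-colouring of $D$ makes $D$ properly connected if for every ordered pair $(u,v)$ of distinct vertices there is a properly coloured directed $uv$-path; $\overrightarrow{pc}(D)$ is the minimum number of colours in such an arc-colouring. For a cycle $C=x_0x_1\dots x_{n-1}x_0$ (indices mod $n$), a chord of $C$ is an arc $x_px_q$ of $D$ with $x_q\ne x_{p+1}$ (and $x_q\ne x_p$); its length is the length of the directed subpath $x_px_{p+1}\dots x_q$ of $C$, and the chord is even if this length is even, odd otherwise. -}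

module Defs where

open import Data.Nat using (ℕ; zero; suc; _+_; _∸_; _≤_; _<_; _%_)
open import Data.Nat.Divisibility using (_∣_)
open import Data.Fin using (Fin)
open import Data.Bool using (Bool; T; false)
open import Data.Product using (Σ; _×_; ∃; ∃-syntax)
open import Relation.Binary.PropositionalEquality using (_≡_; _≢_)

-- A digraph of order n on vertex set Fin n: an adjacency relation
-- (Bool-valued, so there are no parallel arcs), loopless.
-- Opposite arcs (adj u v and adj v u) are allowed.
record Digraph (n : ℕ) : Set where
  field
    adj      : Fin n → Fin n → Bool
    loopless : ∀ v → adj v v ≡ false
open Digraph public

Arc : ∀ {n} → Digraph n → Fin n → Fin n → Set
Arc D u v = T (adj D u v)

_mod_ : ℕ → ℕ → ℕ
i mod zero = i
i mod suc k = i % suc k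

-- A Hamiltonian cycle x_0 x_1 ... x_{n-1} x_0 of D, given by x : ℕ → Fin n
-- (only the values at 0..n-1 matter): the x_i are pairwise distinct,
-- cover all vertices, and x_i x_{i+1 mod n} is an arc for every i < n.
record HamCycle {n : ℕ} (D : Digraph n) : Set where
  field
    x        : ℕ → Fin n
    order≥2  : 2 ≤ n
    injective : ∀ i j → i < n → j < n → x i ≡ x j → i ≡ j
    covers   : ∀ v → ∃[ i ] (i < n × x i ≡ v)
    arcs     : ∀ i → i < n → Arc D (x i) (x (suc i mod n))
open HamCycle public

-- Length of the directed subpath x_p x_{p+1} ... x_q of C (p, q < n).
chordLength : (n p q : ℕ) → ℕ
chordLength n p q = ((q + n) ∸ p) mod n

IsChord : ∀ {n} (D : Digraph n) (C : HamCycle D) (p q : ℕ) → Set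
IsChord {n} D C p q =
  p < n × q < n × Arc D (x C p) (x C q)
  × x C q ≢ x C (suc p mod n) × x C q ≢ x C p

HeadOfEvenChord : ∀ {n} (D : Digraph n) (C : HamCycle D) → Fin n → Set
HeadOfEvenChord {n} D C v =
  ∃[ p ] ∃[ q ] (IsChord D C p q × x C q ≡ v × 2 ∣ chordLength n p q)

-- An arc-colouring with k colours (only the values on arcs matter).
Colouring : ℕ → ℕ → Set
Colouring n k = Fin n → Fin n → Fin k

record PCPath {n k : ℕ} (D : Digraph n) (c : Colouring n k) (u v : Fin n) : Set where
  field
    len      : ℕ
    w        : ℕ → Fin n
    start    : w 0 ≡ u
    end      : w len ≡ v
    arcs     : ∀ i → i < len → Arc D (w i) (w (suc i))
    distinct : ∀ i j → i ≤ len → j ≤ len → w i ≡ w j → i ≡ j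
    proper   : ∀ i → suc i < len →
               c (w i) (w (suc i)) ≢ c (w (suc i)) (w (suc (suc i)))

ProperlyConnects : ∀ {n k} (D : Digraph n) → Colouring n k → Set
ProperlyConnects {n} D c = ∀ (u v : Fin n) → u ≢ v → PCPath D c u v

pc≤ : ∀ {n} → Digraph n → ℕ → Set
pc≤ {n} D k = Σ (Colouring n k) (ProperlyConnects D)

-- Choose for every vertex an even chord of C entering it, and let p → q be the shortest of
-- them. Rank the positions of C starting just after p, so that p gets the last rank n - 1,
-- and colour every arc by the parity of the rank of its tail. A cycle arc not leaving p, and
-- an even chord wrapping around past p, join ranks of different parity (the wrap adds the
-- odd n), so every path along such arcs is properly coloured. These arcs connect everything:
-- the cycle climbs to p, the chord p → q wraps down to rank h of q, the cycle climbs from h,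
-- and a vertex of rank j < h is entered by its chosen chord, which is at least as long as
-- p → q, hence wraps, hence comes from a higher rank.
module Submission where

open import Defs
open import Data.Fin as Fin using (Fin)
open import Data.List using (allFin)
open import Data.List.Extrema.Nat using (argmin; f[argmin]≤f[xs])
import Data.List.Relation.Unary.All as All
open import Data.List.Membership.Propositional.Properties using (∈-allFin)
open import Data.Nat using (ℕ; zero; suc; _+_; _∸_; _≤_; _<_; _≤′_; ≤′-refl; ≤′-step; _%_; NonZero; z≤n; s≤s; s≤s⁻¹; _<?_; _≤?_)
open import Data.Nat.Properties
open import Algebra.Properties.CommutativeSemigroup +-commutativeSemigroup using (interchange; xy∙z≈xz∙y)
open import Data.Nat.DivMod using (m%n%n≡m%n; [m+n]%n≡m%n; %-distribˡ-+; m%n<n; m<n⇒m%n≡m)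
open import Data.Nat.Divisibility using (_∣_; _∣0; ∣-refl; m∣m*n; ∣1⇒≡1; ∣m∣n⇒∣m+n; ∣m+n∣m⇒∣n)
open import Data.Nat.Induction using (<-wellFounded)
open import Data.Product using (_×_; _,_; proj₁; proj₂; ∃-syntax)
open import Data.Sum using (_⊎_; inj₁; inj₂; fromInj₂)
open import Function using (_∘_)
open import Induction.WellFounded using (Acc; acc)
open import Level using (0ℓ)
open import Relation.Binary.Bundles using (Setoid)
open import Relation.Binary.Definitions using (DecidableEquality)
import Relation.Binary.Reasoning.Setoid as SetoidReasoning
open import Relation.Binary.PropositionalEquality
open import Relation.Binary.Construct.Closure.ReflexiveTransitive using (Star; ε; _◅_; _◅◅_)
open import Relation.Nullary using (¬_; yes; no; contradiction)

par : ℕ → Fin 2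
par zero          = Fin.zero
par (suc zero)    = Fin.suc Fin.zero
par (suc (suc n)) = par n

par≡⇒2∣+ : ∀ a b → par a ≡ par b → 2 ∣ a + b
par≡⇒2∣+ zero          zero          _  = 2 ∣0
par≡⇒2∣+ zero          (suc (suc b)) eq = ∣m∣n⇒∣m+n ∣-refl (par≡⇒2∣+ zero b eq)
par≡⇒2∣+ (suc zero)    (suc zero)    _  = ∣-refl
par≡⇒2∣+ (suc zero)    (suc (suc b)) eq = ∣m∣n⇒∣m+n ∣-refl (par≡⇒2∣+ 1 b eq)
par≡⇒2∣+ (suc (suc a)) b             eq = ∣m∣n⇒∣m+n ∣-refl (par≡⇒2∣+ a b eq)

par-≢ : ∀ {a b l k} → a + l ≡ b + k → ¬ 2 ∣ l + k → par a ≢ par b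
par-≢ {a} {b} {l} {k} eq odd same = odd (∣m+n∣m⇒∣n 2∣sum (par≡⇒2∣+ a b same))
  where
  2∣double : ∀ n → 2 ∣ n + n
  2∣double n = subst (2 ∣_) (cong (n +_) (+-identityʳ n)) (m∣m*n n)

  2∣sum : 2 ∣ (a + b) + (l + k)
  2∣sum = subst (2 ∣_) (sym (trans (interchange a b l k) (cong (_+ (b + k)) eq))) (2∣double (b + k))

¬2∣1 : ¬ 2 ∣ 1
¬2∣1 2∣1 = contradiction (∣1⇒≡1 2∣1) λ ()

m+n≡o+p∧n<p⇒o<m : ∀ {m n o p} → m + n ≡ o + p → n < p → o < m
m+n≡o+p∧n<p⇒o<m {m} {n} {o} {p} eq n<p = +-cancelʳ-< p o m (subst (_< m + p) eq (+-monoʳ-< m n<p))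

module Modular (N : ℕ) .{{_ : NonZero N}} where

  -- A record rather than a synonym for a % N ≡ b % N, so that a and b are inferable from a proof.
  infix 4 _≈_
  record _≈_ (a b : ℕ) : Set where
    constructor mod-≡
    field %-≡ : a % N ≡ b % N
  open _≈_ public

  ≈-setoid : Setoid 0ℓ 0ℓ
  ≈-setoid = record
    { Carrier       = ℕ
    ; _≈_           = _≈_
    ; isEquivalence = record
      { refl  = mod-≡ refl
      ; sym   = λ (mod-≡ p) → mod-≡ (sym p)
      ; trans = λ (mod-≡ p) (mod-≡ q) → mod-≡ (trans p q) } }

  open Setoid ≈-setoid public using ()
    renaming (refl to ≈-refl; reflexive to ≈-reflexive; trans to ≈-trans)
  module ≈-Reasoning = SetoidReasoning ≈-setoid

  %-≈ : ∀ a → a % N ≈ a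
  %-≈ a = mod-≡ (m%n%n≡m%n a N)

  +N-≈ : ∀ a → a + N ≈ a
  +N-≈ a = mod-≡ ([m+n]%n≡m%n a N)

  +-≈ : ∀ {a b c d} → a ≈ b → c ≈ d → a + c ≈ b + d
  +-≈ {a} {b} {c} {d} (mod-≡ a≈b) (mod-≡ c≈d) = mod-≡ (begin
    (a + c) % N         ≡⟨ %-distribˡ-+ a c N ⟩
    (a % N + c % N) % N ≡⟨ cong₂ (λ s t → (s + t) % N) a≈b c≈d ⟩
    (b % N + d % N) % N ≡⟨ %-distribˡ-+ b d N ⟨
    (b + d) % N         ∎)
    where open ≡-Reasoning

  ≈⇒≡ : ∀ {a b} → a < N → b < N → a ≈ b → a ≡ b
  ≈⇒≡ a<N b<N (mod-≡ a≈b) = trans (sym (m<n⇒m%n≡m a<N)) (trans a≈b (m<n⇒m%n≡m b<N))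

  ≈⇒≡⊎≡+N : ∀ {a b} → a < N + N → b < N → a ≈ b → a ≡ b ⊎ a ≡ b + N
  ≈⇒≡⊎≡+N {a} {b} a<2N b<N a≈b with a <? N
  ... | yes a<N = inj₁ (≈⇒≡ a<N b<N a≈b)
  ... | no a≮N = inj₂ (trans (sym a∸N+N≡a) (cong (_+ N) (≈⇒≡ a∸N<N b<N a∸N≈b)))
    where
    a∸N+N≡a : a ∸ N + N ≡ a
    a∸N+N≡a = m∸n+n≡m (≮⇒≥ a≮N)
    a∸N<N : a ∸ N < N
    a∸N<N = +-cancelʳ-< N (a ∸ N) N (subst (_< N + N) (sym a∸N+N≡a) a<2N)
    a∸N≈b : a ∸ N ≈ b
    a∸N≈b = begin
      a ∸ N     ≈⟨ +N-≈ (a ∸ N) ⟨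
      a ∸ N + N ≡⟨ a∸N+N≡a ⟩
      a         ≈⟨ a≈b ⟩
      b         ∎
      where open ≈-Reasoning

-- Ranks along a cycle of length N = suc m read from position suc p, so that p gets rank m.
module Rotation (m p : ℕ) (p≤m : p ≤ m) where

  open Modular (suc m)

  rank : ℕ → ℕ
  rank i = (i + (m ∸ p)) % suc m

  unrank : ℕ → ℕ
  unrank k = (k + suc p) % suc m

  rank<N : ∀ i → rank i < suc m
  rank<N i = m%n<n (i + (m ∸ p)) (suc m)

  rank≤m : ∀ i → rank i ≤ m
  rank≤m i = s≤s⁻¹ (rank<N i)

  unrank<N : ∀ k → unrank k < suc m
  unrank<N k = m%n<n (k + suc p) (suc m)

  rank-p : rank p ≡ m
  rank-p = trans (cong (_% suc m) (m+[n∸m]≡n p≤m)) (m<n⇒m%n≡m (n<1+n m))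

  rank-+ : ∀ i l {j} → i + l ≈ j → rank i + l ≈ rank j
  rank-+ i l {j} i+l≈j = begin
    rank i + l          ≈⟨ +-≈ (%-≈ (i + (m ∸ p))) ≈-refl ⟩
    i + (m ∸ p) + l     ≡⟨ xy∙z≈xz∙y i (m ∸ p) l ⟩
    i + l + (m ∸ p)     ≈⟨ +-≈ i+l≈j ≈-refl ⟩
    j + (m ∸ p)         ≈⟨ %-≈ (j + (m ∸ p)) ⟨
    rank j              ∎
    where open ≈-Reasoning

  rank-unrank : ∀ {k} → k < suc m → rank (unrank k) ≡ k
  rank-unrank {k} k<N = ≈⇒≡ (rank<N (unrank k)) k<N (begin
    rank (unrank k)         ≈⟨ %-≈ (unrank k + (m ∸ p)) ⟩
    unrank k + (m ∸ p)      ≈⟨ +-≈ (%-≈ (k + suc p)) ≈-refl ⟩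
    k + suc p + (m ∸ p)     ≡⟨ +-assoc k (suc p) (m ∸ p) ⟩
    k + suc (p + (m ∸ p))   ≡⟨ cong (λ t → k + suc t) (m+[n∸m]≡n p≤m) ⟩
    k + suc m               ≈⟨ +N-≈ k ⟩
    k                       ∎)
    where open ≈-Reasoning

  unrank-rank : ∀ {i} → i < suc m → unrank (rank i) ≡ i
  unrank-rank {i} i<N = ≈⇒≡ (unrank<N (rank i)) i<N (begin
    unrank (rank i)         ≈⟨ %-≈ (rank i + suc p) ⟩
    rank i + suc p          ≈⟨ +-≈ (%-≈ (i + (m ∸ p))) ≈-refl ⟩
    i + (m ∸ p) + suc p     ≡⟨ +-assoc i (m ∸ p) (suc p) ⟩
    i + (m ∸ p + suc p)     ≡⟨ cong (i +_) (trans (+-suc (m ∸ p) p) (cong suc (m∸n+n≡m p≤m))) ⟩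
    i + suc m               ≈⟨ +N-≈ i ⟩
    i                       ∎)
    where open ≈-Reasoning

  suc-unrank : ∀ k → suc (unrank k) % suc m ≡ unrank (suc k)
  suc-unrank k = %-≡ (+-≈ {1} ≈-refl (%-≈ (k + suc p)))

module RankedWalks {V : Set} (B : V → V → Set) (at : ℕ → V) (m h : ℕ)
  (step : ∀ k → k < m → B (at k) (at (suc k)))
  (top  : B (at m) (at h))
  (back : ∀ j → j < h → ∃[ i ] (j < i × i ≤ m × B (at i) (at j)))
  where

  ascend : ∀ {a b} → a ≤′ b → b ≤ m → Star B (at a) (at b)
  ascend ≤′-refl        _     = ε
  ascend (≤′-step a≤′b) b<m = ascend a≤′b (<⇒≤ b<m) ◅◅ step _ b<m ◅ ε

  descend : ∀ j → Acc _<_ (m ∸ j) → j ≤ m → Star B (at m) (at j)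
  descend j (acc smaller) j≤m with h ≤? j
  ... | yes h≤j = top ◅ ascend (≤⇒≤′ h≤j) j≤m
  ... | no  h≰j with back j (≰⇒> h≰j)
  ...   | i , j<i , i≤m , arc = descend i (smaller (∸-monoʳ-< j<i i≤m)) i≤m ◅◅ arc ◅ ε

  connected : ∀ {a b} → a ≤ m → b ≤ m → Star B (at a) (at b)
  connected {a} {b} a≤m b≤m = ascend (≤⇒≤′ a≤m) ≤-refl ◅◅ descend b (<-wellFounded (m ∸ b)) b≤m

record SimplePath {V : Set} (B : V → V → Set) (u v : V) : Set where
  field
    len      : ℕ
    w        : ℕ → V
    start    : w 0 ≡ u
    end      : w len ≡ v
    steps    : ∀ i → i < len → B (w i) (w (suc i))
    distinct : ∀ i j → i ≤ len → j ≤ len → w i ≡ w j → i ≡ j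

module _ {V : Set} {B : V → V → Set} where

  open SimplePath

  trivial : ∀ u → SimplePath B u u
  trivial u = record
    { len = 0 ; w = λ _ → u ; start = refl ; end = refl ; steps = λ _ ()
    ; distinct = λ { _ _ z≤n z≤n _ → refl } }

  suffix : ∀ {u v} (P : SimplePath B u v) {k} → k ≤ len P → SimplePath B (w P k) v
  suffix P {k} k≤len = record
    { len      = len P ∸ k
    ; w        = λ i → w P (k + i)
    ; start    = cong (w P) (+-identityʳ k)
    ; end      = trans (cong (w P) (m+[n∸m]≡n k≤len)) (end P)
    ; steps    = λ i i<len → subst (λ j → B (w P (k + i)) (w P j)) (sym (+-suc k i))
                   (steps P (k + i) (subst (_≤ len P) (+-suc k i) (shifted i<len)))
    ; distinct = λ i j i≤len j≤len eq →
                   +-cancelˡ-≡ k i j (distinct P (k + i) (k + j) (shifted i≤len) (shifted j≤len) eq) }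
    where
    shifted : ∀ {i} → i ≤ len P ∸ k → k + i ≤ len P
    shifted {i} i≤ = subst (k + i ≤_) (m+[n∸m]≡n k≤len) (+-monoʳ-≤ k i≤)

  prepend : ∀ {u u′ v} → B u u′ → (P : SimplePath B u′ v) →
            (∀ k → k ≤ len P → w P k ≢ u) → SimplePath B u v
  prepend {u} b P fresh = record
    { len = suc (len P) ; w = w′ ; start = refl ; end = end P ; steps = steps′ ; distinct = distinct′ }
    where
    w′ : ℕ → V
    w′ zero    = u
    w′ (suc i) = w P i

    steps′ : ∀ i → i < suc (len P) → B (w′ i) (w′ (suc i))
    steps′ zero    _       = subst (B u) (sym (start P)) b
    steps′ (suc i) i<1+len = steps P i (s≤s⁻¹ i<1+len)

    distinct′ : ∀ i j → i ≤ suc (len P) → j ≤ suc (len P) → w′ i ≡ w′ j → i ≡ j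
    distinct′ zero    zero    _         _         _  = refl
    distinct′ zero    (suc j) _         (s≤s j≤)  eq = contradiction (sym eq) (fresh j j≤)
    distinct′ (suc i) zero    (s≤s i≤)  _         eq = contradiction eq (fresh i i≤)
    distinct′ (suc i) (suc j) (s≤s i≤)  (s≤s j≤)  eq = cong suc (distinct P i j i≤ j≤ eq)

module _ {V : Set} (_≟_ : DecidableEquality V) {B : V → V → Set} where

  open SimplePath

  extend : ∀ {u u′ v} → B u u′ → SimplePath B u′ v → SimplePath B u v
  extend {u} b P with anyUpTo? (λ k → w P k ≟ u) (suc (len P))
  ... | yes (k , k<1+len , wk≡u) = subst (λ t → SimplePath B t _) wk≡u (suffix P (s≤s⁻¹ k<1+len))
  ... | no  absent               = prepend b P λ k k≤len wk≡u → absent (k , s≤s k≤len , wk≡u)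

  shorten : ∀ {u v} → Star B u v → SimplePath B u v
  shorten ε       = trivial _
  shorten (b ◅ r) = extend b (shorten r)

module CycleIndex {m : ℕ} {D : Digraph (suc m)} (C : HamCycle D) where

  open Modular (suc m)

  index : Fin (suc m) → ℕ
  index v = proj₁ (covers C v)

  index<N : ∀ v → index v < suc m
  index<N v = proj₁ (proj₂ (covers C v))

  x-index : ∀ v → x C (index v) ≡ v
  x-index v = proj₂ (proj₂ (covers C v))

  index-x : ∀ {i} → i < suc m → index (x C i) ≡ i
  index-x i<N = injective C _ _ (index<N _) i<N (x-index _)

  chordLength-≈ : ∀ {p} q → p < suc m → p + chordLength (suc m) p q ≈ q
  chordLength-≈ {p} q p<N = begin
    p + chordLength (suc m) p q ≈⟨ +-≈ ≈-refl (%-≈ (q + suc m ∸ p)) ⟩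
    p + (q + suc m ∸ p)         ≡⟨ m+[n∸m]≡n (≤-trans (<⇒≤ p<N) (m≤n+m (suc m) q)) ⟩
    q + suc m                   ≈⟨ +N-≈ q ⟩
    q                           ∎
    where open ≈-Reasoning

  record EvenChordInto (v : Fin (suc m)) : Set where
    field
      tail     : ℕ
      length   : ℕ
      tail<N   : tail < suc m
      length<N : length < suc m
      length>0 : 0 < length
      even     : 2 ∣ length
      arc      : Arc D (x C tail) v
      closes   : tail + length ≈ index v

  evenChordInto : ∀ v → HeadOfEvenChord D C v → EvenChordInto v
  evenChordInto v (p , q , (p<N , q<N , arc , _ , xq≢xp) , xq≡v , 2∣ℓ) = record
    { tail     = p
    ; length   = chordLength (suc m) p q
    ; tail<N   = p<N
    ; length<N = m%n<n (q + suc m ∸ p) (suc m)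
    ; length>0 = n≢0⇒n>0 λ ℓ≡0 → xq≢xp (cong (x C) (sym (≈⇒≡ p<N q<N (p≈q ℓ≡0))))
    ; even     = 2∣ℓ
    ; arc      = subst (Arc D (x C p)) xq≡v arc
    ; closes   = ≈-trans (chordLength-≈ q p<N) (≈-reflexive q≡index)
    }
    where
    p≈q : chordLength (suc m) p q ≡ 0 → p ≈ q
    p≈q ℓ≡0 = begin
      p                           ≡⟨ +-identityʳ p ⟨
      p + 0                       ≡⟨ cong (p +_) ℓ≡0 ⟨
      p + chordLength (suc m) p q ≈⟨ chordLength-≈ q p<N ⟩
      q                           ∎
      where open ≈-Reasoning

    q≡index : q ≡ index v
    q≡index = trans (sym (index-x q<N)) (cong index xq≡v)

module ProperConnection {m : ℕ} (odd : ¬ 2 ∣ suc m) {D : Digraph (suc m)} (C : HamCycle D)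
  (heads : ∀ v → HeadOfEvenChord D C v) where

  open Modular (suc m)
  open CycleIndex C
  open EvenChordInto

  chord : ∀ v → EvenChordInto v
  chord v = evenChordInto v (heads v)

  shortest : Fin (suc m)
  shortest = argmin (length ∘ chord) Fin.zero (allFin (suc m))

  shortest-minimal : ∀ v → length (chord shortest) ≤ length (chord v)
  shortest-minimal v = All.lookup (f[argmin]≤f[xs] {f = length ∘ chord} Fin.zero (allFin (suc m))) (∈-allFin v)

  open Rotation m (tail (chord shortest)) (s≤s⁻¹ (tail<N (chord shortest)))

  colour : Fin (suc m) → Fin 2
  colour v = par (rank (index v))

  Alternating : Fin (suc m) → Fin (suc m) → Set
  Alternating u v = Arc D u v × colour u ≢ colour v

  at : ℕ → Fin (suc m)
  at k = x C (unrank k)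

  at-rank : ∀ {i} → i < suc m → at (rank i) ≡ x C i
  at-rank i<N = cong (x C) (unrank-rank i<N)

  at-rank-index : ∀ v → at (rank (index v)) ≡ v
  at-rank-index v = trans (at-rank (index<N v)) (x-index v)

  rank-index-at : ∀ {k} → k < suc m → rank (index (at k)) ≡ k
  rank-index-at {k} k<N = trans (cong rank (index-x (unrank<N k))) (rank-unrank k<N)

  colour-x : ∀ {i} → i < suc m → colour (x C i) ≡ par (rank i)
  colour-x i<N = cong (par ∘ rank) (index-x i<N)

  cycle-alternates : ∀ k → k < m → Alternating (at k) (at (suc k))
  cycle-alternates k k<m =
    subst (λ i → Arc D (at k) (x C i)) (suc-unrank k) (arcs C (unrank k) (unrank<N k)) ,
    λ same → par-≢ {k} {suc k} {1} {0} k+1≡1+k+0 ¬2∣1 (begin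
      par k                      ≡⟨ cong par (rank-index-at (m<n⇒m<1+n k<m)) ⟨
      colour (at k)              ≡⟨ same ⟩
      colour (at (suc k))        ≡⟨ cong par (rank-index-at (s≤s k<m)) ⟩
      par (suc k)                ∎)
    where
    open ≡-Reasoning
    k+1≡1+k+0 : k + 1 ≡ suc k + 0
    k+1≡1+k+0 = trans (+-comm k 1) (sym (+-identityʳ (suc k)))

  tailRank : Fin (suc m) → ℕ
  tailRank v = rank (tail (chord v))

  chord-closes : ∀ v → tailRank v + length (chord v) ≡ rank (index v)
                     ⊎ tailRank v + length (chord v) ≡ rank (index v) + suc m
  chord-closes v = ≈⇒≡⊎≡+N
    (+-mono-< (rank<N (tail (chord v))) (length<N (chord v))) (rank<N (index v))
    (rank-+ (tail (chord v)) (length (chord v)) (closes (chord v)))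

  wrapping-chord-alternates : ∀ v → tailRank v + length (chord v) ≡ rank (index v) + suc m →
                              Alternating (x C (tail (chord v))) v
  wrapping-chord-alternates v wraps =
    arc (chord v) ,
    λ same → par-≢ {tailRank v} {rank (index v)} {length (chord v)} {suc m} wraps
                   (λ 2∣ℓ+N → odd (∣m+n∣m⇒∣n 2∣ℓ+N (even (chord v))))
                   (trans (sym (colour-x (tail<N (chord v)))) same)

  short-chord-wraps : ∀ v → rank (index v) < length (chord v) →
                      tailRank v + length (chord v) ≡ rank (index v) + suc m
  short-chord-wraps v short = fromInj₂ (λ closes → contradiction
    (subst (length (chord v) ≤_) closes (m≤n+m (length (chord v)) (tailRank v))) (<⇒≱ short))
    (chord-closes v)

  h : ℕ
  h = rank (index shortest)

  shortest-wraps : tailRank shortest + length (chord shortest) ≡ h + suc m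
  shortest-wraps = fromInj₂ (λ closes → contradiction
    (subst (m <_) (trans (cong (_+ length (chord shortest)) (sym rank-p)) closes)
                  (m<m+n m (length>0 (chord shortest))))
    (≤⇒≯ (rank≤m (index shortest))))
    (chord-closes shortest)

  top : Alternating (at m) (at h)
  top = subst₂ Alternating (trans (sym (at-rank (tail<N (chord shortest)))) (cong at rank-p))
                           (sym (at-rank-index shortest))
                           (wrapping-chord-alternates shortest shortest-wraps)

  h<shortest : h < length (chord shortest)
  h<shortest = m+n≡o+p∧n<p⇒o<m (trans (+-comm (length (chord shortest)) (tailRank shortest)) shortest-wraps)
                           (subst (_< suc m) (sym rank-p) (n<1+n m))

  back : ∀ j → j < h → ∃[ i ] (j < i × i ≤ m × Alternating (at i) (at j))
  back j j<h = tailRank v , j<i , rank≤m (tail (chord v)) ,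
               subst (λ u → Alternating u v) (sym (at-rank (tail<N (chord v)))) (wrapping-chord-alternates v wraps)
    where
    v : Fin (suc m)
    v = at j
    rank-v : rank (index v) ≡ j
    rank-v = rank-index-at (<-trans j<h (rank<N (index shortest)))
    wraps : tailRank v + length (chord v) ≡ rank (index v) + suc m
    wraps = short-chord-wraps v (subst (_< length (chord v)) (sym rank-v)
              (<-≤-trans (<-trans j<h h<shortest) (shortest-minimal v)))
    j<i : j < tailRank v
    j<i = subst (_< tailRank v) rank-v (m+n≡o+p∧n<p⇒o<m wraps (length<N (chord v)))

  open RankedWalks Alternating at m h cycle-alternates top back

  alternating-walk : ∀ u v → Star Alternating u v
  alternating-walk u v = subst₂ (Star Alternating) (at-rank-index u) (at-rank-index v)
                           (connected (rank≤m (index u)) (rank≤m (index v)))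

  colouring : Colouring (suc m) 2
  colouring u _ = colour u

  properly-coloured : ∀ {u v} → SimplePath Alternating u v → PCPath D colouring u v
  properly-coloured P = record
    { len = len ; w = w ; start = start ; end = end ; distinct = distinct
    ; arcs   = λ i i<len → proj₁ (steps i i<len)
    ; proper = λ i 1+i<len → proj₂ (steps i (<-trans (n<1+n i) 1+i<len)) }
    where open SimplePath P

  properly-connected : pc≤ D 2
  properly-connected = colouring , λ u v _ → properly-coloured (shorten Fin._≟_ (alternating-walk u v))

corollary3 : (n : ℕ) → ¬ (2 ∣ n) → (D : Digraph n) → (C : HamCycle D) →
    (∀ (v : Fin n) → HeadOfEvenChord D C v) → pc≤ D 2
corollary3 zero    _   _ C _     = contradiction (order≥2 C) λ ()
corollary3 (suc m) odd _ C heads = ProperConnection.properly-connected odd C heads
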